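{- For a positive integer $m$, let $z_m$ be the optimal value of the linear program \[ \min\sum_{k,\ell=1}^m\frac{2}{k\ell}Y_{k,\ell}\quad\text{subject to}\quad\sum_{\ell=1}^m(Y_{k,\ell}+Y_{\ell,k})\geq\varphi(k)\ (k=1,\dots,m),\quad Y\geq 0,\ Y\in\mathbb{R}^{m\times m}. \] Then $z_{m+1}\leq z_m+\dfrac{\varphi(m+1)}{(m+1)^2}$ for every positive integer $m$.
   Context: $\varphi$ denotes Euler's totient function.
   Formalization: The variable Y of the linear program has entries in ℚ rather than ℝ, so the optimal values z_m are minima over rational feasible points and are rational. -}

module Defs where

open import Data.Nat using (ℕ; zero; suc; _+_; _*_)
open import Data.Nat.GCD using (gcd)
open import Data.Nat.Properties using (_≟_)
open import Data.Fin using (Fin; toℕ)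
import Data.Fin as Fin
open import Data.Integer using (+_)
open import Data.Rational using (ℚ; 0ℚ; _/_; _≤_) renaming (_+_ to _+ℚ_; _*_ to _*ℚ_)
open import Data.Product using (Σ; _×_)
open import Relation.Binary.PropositionalEquality using (_≡_)
open import Relation.Nullary.Decidable using (does)
open import Data.Bool using (if_then_else_)

φ-aux : ℕ → ℕ → ℕ
φ-aux k zero = 0
φ-aux k (suc i) = (if does (gcd (suc i) k ≟ 1) then 1 else 0) + φ-aux k i

φ : ℕ → ℕ
φ k = φ-aux k k

∑ : (n : ℕ) → (Fin n → ℚ) → ℚ
∑ zero f = 0ℚ
∑ (suc n) f = f Fin.zero +ℚ ∑ n (λ i → f (Fin.suc i))

-- index i : Fin m stands for the integer toℕ i + 1 ∈ {1,…,m}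
Matrix : ℕ → Set
Matrix m = Fin m → Fin m → ℚ

objective : (m : ℕ) → Matrix m → ℚ
objective m Y = ∑ m λ k → ∑ m λ l →
  ((+ 2) / (suc (toℕ k) * suc (toℕ l))) *ℚ Y k l

Feasible : (m : ℕ) → Matrix m → Set
Feasible m Y =
  ((k : Fin m) → ((+ φ (suc (toℕ k))) / 1) ≤ ∑ m (λ l → Y k l +ℚ Y l k))
  × ((k l : Fin m) → 0ℚ ≤ Y k l)

IsOptimalValue : (m : ℕ) → ℚ → Set
IsOptimalValue m z =
  Σ (Matrix m) (λ Y → Feasible m Y × objective m Y ≡ z)
  × ((Y : Matrix m) → Feasible m Y → z ≤ objective m Y)

-- Extend an optimal solution Y of the m-problem by the block φ(m+1)/2 in the new diagonal
-- entry and zeros elsewhere.  The new constraint row reads 2 · φ(m+1)/2 ≥ φ(m+1), the old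
-- rows are unchanged, and the objective grows by (2/(m+1)²) · φ(m+1)/2; minimality of
-- z_{m+1} then gives the bound.
module Submission where

open import Defs
open import Data.Nat using (ℕ; suc; _*_)
open import Data.Integer using (+_)
open import Data.Rational using (ℚ; _/_; _≤_; _+_)

open import Data.Nat using (zero)
open import Data.Fin using (Fin; toℕ; inject₁; fromℕ)
import Data.Fin as Fin
open import Data.Fin.Properties using (toℕ-inject₁; toℕ-fromℕ)
open import Data.Product using (_,_)
open import Data.Rational using (0ℚ; toℚᵘ) renaming (_*_ to _*ℚ_)
open import Data.Rational.Properties
  using ( +-identityˡ; +-identityʳ; +-assoc; *-zeroʳ; ≤-refl; ≤-reflexive
        ; nonNegative⁻¹; normalize-nonNeg
        ; toℚᵘ-injective; toℚᵘ-homo-+; toℚᵘ-homo-*; toℚᵘ-fromℚᵘ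
        ; module ≤-Reasoning )
import Data.Rational.Unnormalised as ℚᵘ
import Data.Rational.Unnormalised.Properties as ℚᵘ
import Data.Integer as ℤ
open import Data.Integer.Tactic.RingSolver using (solve-∀)
open import Relation.Binary.PropositionalEquality
  using (_≡_; refl; sym; trans; cong; cong₂; subst; subst₂; module ≡-Reasoning)

private
  variable
    n : ℕ
    A : Set

_∷ʳ_ : (Fin n → A) → A → Fin (suc n) → A
_∷ʳ_ {zero}  f x Fin.zero    = x
_∷ʳ_ {suc n} f x Fin.zero    = f Fin.zero
_∷ʳ_ {suc n} f x (Fin.suc i) = ((λ j → f (Fin.suc j)) ∷ʳ x) i

∷ʳ-inject₁ : (f : Fin n → A) (x : A) (i : Fin n) → (f ∷ʳ x) (inject₁ i) ≡ f i
∷ʳ-inject₁ f x Fin.zero    = refl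
∷ʳ-inject₁ f x (Fin.suc i) = ∷ʳ-inject₁ (λ j → f (Fin.suc j)) x i

∷ʳ-fromℕ : (f : Fin n → A) (x : A) → (f ∷ʳ x) (fromℕ n) ≡ x
∷ʳ-fromℕ {zero}  f x = refl
∷ʳ-fromℕ {suc n} f x = ∷ʳ-fromℕ (λ j → f (Fin.suc j)) x

inject₁-fromℕ-elim : (P : Fin (suc n) → Set) →
                     (∀ i → P (inject₁ i)) → P (fromℕ n) → ∀ k → P k
inject₁-fromℕ-elim {zero}  P Pinj Plast Fin.zero    = Plast
inject₁-fromℕ-elim {suc n} P Pinj Plast Fin.zero    = Pinj Fin.zero
inject₁-fromℕ-elim {suc n} P Pinj Plast (Fin.suc k) =
  inject₁-fromℕ-elim (λ j → P (Fin.suc j)) (λ i → Pinj (Fin.suc i)) Plast k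

∑-cong : ∀ n {f g : Fin n → ℚ} → (∀ i → f i ≡ g i) → ∑ n f ≡ ∑ n g
∑-cong zero    f≡g = refl
∑-cong (suc n) f≡g = cong₂ _+_ (f≡g Fin.zero) (∑-cong n (λ i → f≡g (Fin.suc i)))

∑-zero : ∀ n → ∑ n (λ _ → 0ℚ) ≡ 0ℚ
∑-zero zero    = refl
∑-zero (suc n) = trans (cong (λ s → 0ℚ + s) (∑-zero n)) (+-identityˡ 0ℚ)

∑-last : ∀ n (f : Fin (suc n) → ℚ) →
         ∑ (suc n) f ≡ ∑ n (λ i → f (inject₁ i)) + f (fromℕ n)
∑-last zero    f = trans (+-identityʳ (f Fin.zero)) (sym (+-identityˡ (f Fin.zero)))
∑-last (suc n) f = trans (cong (λ s → f Fin.zero + s) (∑-last n (λ i → f (Fin.suc i))))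
                         (sym (+-assoc (f Fin.zero) _ _))

∑-last-zero : ∀ n (f : Fin (suc n) → ℚ) → f (fromℕ n) ≡ 0ℚ →
              ∑ (suc n) f ≡ ∑ n (λ i → f (inject₁ i))
∑-last-zero n f fₙ≡0 = begin
  ∑ (suc n) f                                ≡⟨ ∑-last n f ⟩
  ∑ n (λ i → f (inject₁ i)) + f (fromℕ n)    ≡⟨ cong (λ s → ∑ n (λ i → f (inject₁ i)) + s) fₙ≡0 ⟩
  ∑ n (λ i → f (inject₁ i)) + 0ℚ             ≡⟨ +-identityʳ _ ⟩
  ∑ n (λ i → f (inject₁ i))                  ∎
  where open ≡-Reasoning

∑-init-zero : ∀ n (f : Fin (suc n) → ℚ) → (∀ i → f (inject₁ i) ≡ 0ℚ) →
              ∑ (suc n) f ≡ f (fromℕ n)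
∑-init-zero n f fᵢ≡0 = begin
  ∑ (suc n) f                                ≡⟨ ∑-last n f ⟩
  ∑ n (λ i → f (inject₁ i)) + f (fromℕ n)    ≡⟨ cong (_+ f (fromℕ n)) (∑-cong n fᵢ≡0) ⟩
  ∑ n (λ _ → 0ℚ) + f (fromℕ n)               ≡⟨ cong (_+ f (fromℕ n)) (∑-zero n) ⟩
  0ℚ + f (fromℕ n)                           ≡⟨ +-identityˡ _ ⟩
  f (fromℕ n)                                ∎
  where open ≡-Reasoning

_⊕_ : Matrix n → ℚ → Matrix (suc n)
Y ⊕ c = (λ i → Y i ∷ʳ 0ℚ) ∷ʳ ((λ _ → 0ℚ) ∷ʳ c)

module _ (Y : Matrix n) (c : ℚ) where

  ⊕-inject₁-inject₁ : ∀ i j → (Y ⊕ c) (inject₁ i) (inject₁ j) ≡ Y i j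
  ⊕-inject₁-inject₁ i j
    rewrite ∷ʳ-inject₁ (λ i → Y i ∷ʳ 0ℚ) ((λ _ → 0ℚ) ∷ʳ c) i = ∷ʳ-inject₁ (Y i) 0ℚ j

  ⊕-inject₁-fromℕ : ∀ i → (Y ⊕ c) (inject₁ i) (fromℕ n) ≡ 0ℚ
  ⊕-inject₁-fromℕ i
    rewrite ∷ʳ-inject₁ (λ i → Y i ∷ʳ 0ℚ) ((λ _ → 0ℚ) ∷ʳ c) i = ∷ʳ-fromℕ (Y i) 0ℚ

  ⊕-fromℕ-inject₁ : ∀ j → (Y ⊕ c) (fromℕ n) (inject₁ j) ≡ 0ℚ
  ⊕-fromℕ-inject₁ j
    rewrite ∷ʳ-fromℕ (λ i → Y i ∷ʳ 0ℚ) ((λ _ → 0ℚ) ∷ʳ c) = ∷ʳ-inject₁ (λ _ → 0ℚ) c j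

  ⊕-fromℕ-fromℕ : (Y ⊕ c) (fromℕ n) (fromℕ n) ≡ c
  ⊕-fromℕ-fromℕ
    rewrite ∷ʳ-fromℕ (λ i → Y i ∷ʳ 0ℚ) ((λ _ → 0ℚ) ∷ʳ c) = ∷ʳ-fromℕ {n} (λ _ → 0ℚ) c

  ⊕-nonNeg : 0ℚ ≤ c → (∀ k l → 0ℚ ≤ Y k l) → ∀ k l → 0ℚ ≤ (Y ⊕ c) k l
  ⊕-nonNeg 0≤c 0≤Y = inject₁-fromℕ-elim (λ k → ∀ l → 0ℚ ≤ (Y ⊕ c) k l)
    (λ i → inject₁-fromℕ-elim (λ l → 0ℚ ≤ (Y ⊕ c) (inject₁ i) l)
      (λ j → subst (0ℚ ≤_) (sym (⊕-inject₁-inject₁ i j)) (0≤Y i j))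
      (subst (0ℚ ≤_) (sym (⊕-inject₁-fromℕ i)) ≤-refl))
    (inject₁-fromℕ-elim (λ l → 0ℚ ≤ (Y ⊕ c) (fromℕ n) l)
      (λ j → subst (0ℚ ≤_) (sym (⊕-fromℕ-inject₁ j)) ≤-refl)
      (subst (0ℚ ≤_) (sym ⊕-fromℕ-fromℕ) 0≤c))

  crossSum-⊕-inject₁ : ∀ i → ∑ (suc n) (λ l → (Y ⊕ c) (inject₁ i) l + (Y ⊕ c) l (inject₁ i))
                           ≡ ∑ n (λ l → Y i l + Y l i)
  crossSum-⊕-inject₁ i = trans
    (∑-last-zero n cross (trans (cong₂ _+_ (⊕-inject₁-fromℕ i) (⊕-fromℕ-inject₁ i)) (+-identityˡ 0ℚ)))
    (∑-cong n (λ l → cong₂ _+_ (⊕-inject₁-inject₁ i l) (⊕-inject₁-inject₁ l i)))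
    where
    cross : Fin (suc n) → ℚ
    cross l = (Y ⊕ c) (inject₁ i) l + (Y ⊕ c) l (inject₁ i)

  crossSum-⊕-fromℕ : ∑ (suc n) (λ l → (Y ⊕ c) (fromℕ n) l + (Y ⊕ c) l (fromℕ n)) ≡ c + c
  crossSum-⊕-fromℕ = trans
    (∑-init-zero n cross (λ j → trans (cong₂ _+_ (⊕-fromℕ-inject₁ j) (⊕-inject₁-fromℕ j)) (+-identityˡ 0ℚ)))
    (cong₂ _+_ ⊕-fromℕ-fromℕ ⊕-fromℕ-fromℕ)
    where
    cross : Fin (suc n) → ℚ
    cross l = (Y ⊕ c) (fromℕ n) l + (Y ⊕ c) l (fromℕ n)

  weightedSum-⊕ : (w : ℕ → ℕ → ℚ) →
                  ∑ (suc n) (λ k → ∑ (suc n) λ l → w (toℕ k) (toℕ l) *ℚ (Y ⊕ c) k l)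
                ≡ ∑ n (λ k → ∑ n λ l → w (toℕ k) (toℕ l) *ℚ Y k l) + w n n *ℚ c
  weightedSum-⊕ w = trans (∑-last n (λ k → ∑ (suc n) (term k))) (cong₂ _+_ (∑-cong n oldRow) newRow)
    where
    term : Fin (suc n) → Fin (suc n) → ℚ
    term k l = w (toℕ k) (toℕ l) *ℚ (Y ⊕ c) k l

    term-zero : ∀ k l → (Y ⊕ c) k l ≡ 0ℚ → term k l ≡ 0ℚ
    term-zero k l Yₖₗ≡0 = trans (cong (w (toℕ k) (toℕ l) *ℚ_) Yₖₗ≡0) (*-zeroʳ (w (toℕ k) (toℕ l)))

    oldRow : ∀ i → ∑ (suc n) (term (inject₁ i)) ≡ ∑ n (λ l → w (toℕ i) (toℕ l) *ℚ Y i l)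
    oldRow i = trans
      (∑-last-zero n (term (inject₁ i)) (term-zero _ _ (⊕-inject₁-fromℕ i)))
      (∑-cong n (λ j → cong₂ _*ℚ_ (cong₂ w (toℕ-inject₁ i) (toℕ-inject₁ j))
                                  (⊕-inject₁-inject₁ i j)))

    newRow : ∑ (suc n) (term (fromℕ n)) ≡ w n n *ℚ c
    newRow = trans
      (∑-init-zero n (term (fromℕ n)) (λ j → term-zero _ _ (⊕-fromℕ-inject₁ j)))
      (cong₂ _*ℚ_ (cong₂ w (toℕ-fromℕ n) (toℕ-fromℕ n)) ⊕-fromℕ-fromℕ)

Feasible-⊕ : (Y : Matrix n) (c : ℚ) → Feasible n Y → (+ φ (suc n)) / 1 ≤ c + c → 0ℚ ≤ c →
             Feasible (suc n) (Y ⊕ c)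
Feasible-⊕ {n} Y c (rows , 0≤Y) φ≤2c 0≤c = rows-⊕ , ⊕-nonNeg Y c 0≤c 0≤Y
  where
  rows-⊕ : ∀ k → (+ φ (suc (toℕ k))) / 1 ≤ ∑ (suc n) (λ l → (Y ⊕ c) k l + (Y ⊕ c) l k)
  rows-⊕ = inject₁-fromℕ-elim _
    (λ i → subst₂ (λ t s → (+ φ (suc t)) / 1 ≤ s)
                  (sym (toℕ-inject₁ i)) (sym (crossSum-⊕-inject₁ Y c i)) (rows i))
    (subst₂ (λ t s → (+ φ (suc t)) / 1 ≤ s)
            (sym (toℕ-fromℕ n)) (sym (crossSum-⊕-fromℕ Y c)) φ≤2c)

objective-⊕ : (Y : Matrix n) (c : ℚ) →
              objective (suc n) (Y ⊕ c) ≡ objective n Y + ((+ 2) / (suc n * suc n)) *ℚ c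
objective-⊕ Y c = weightedSum-⊕ Y c (λ a b → (+ 2) / (suc a * suc b))

-- i / suc d is by definition the normalisation of mkℚᵘ i d.
/-toℚᵘ : ∀ i d → toℚᵘ (i / suc d) ℚᵘ.≃ ℚᵘ.mkℚᵘ i d
/-toℚᵘ i d = toℚᵘ-fromℚᵘ (ℚᵘ.mkℚᵘ i d)

half+half : ∀ i → i / 2 + i / 2 ≡ i / 1
half+half i = toℚᵘ-injective (begin
  toℚᵘ (i / 2 + i / 2)                    ≈⟨ toℚᵘ-homo-+ (i / 2) (i / 2) ⟩
  toℚᵘ (i / 2) ℚᵘ.+ toℚᵘ (i / 2)          ≈⟨ ℚᵘ.+-cong (/-toℚᵘ i 1) (/-toℚᵘ i 1) ⟩
  ℚᵘ.mkℚᵘ i 1 ℚᵘ.+ ℚᵘ.mkℚᵘ i 1            ≈⟨ ℚᵘ.*≡* (identity i) ⟩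
  ℚᵘ.mkℚᵘ i 0                             ≈⟨ /-toℚᵘ i 0 ⟨
  toℚᵘ (i / 1)                            ∎)
  where
  open ℚᵘ.≃-Reasoning
  identity : ∀ i → (i ℤ.* + 2 ℤ.+ i ℤ.* + 2) ℤ.* + 1 ≡ i ℤ.* (+ 2 ℤ.* + 2)
  identity = solve-∀

two/d*half : ∀ i d → ((+ 2) / suc d) *ℚ (i / 2) ≡ i / suc d
two/d*half i d = toℚᵘ-injective (begin
  toℚᵘ (((+ 2) / suc d) *ℚ (i / 2))            ≈⟨ toℚᵘ-homo-* ((+ 2) / suc d) (i / 2) ⟩
  toℚᵘ ((+ 2) / suc d) ℚᵘ.* toℚᵘ (i / 2)       ≈⟨ ℚᵘ.*-cong (/-toℚᵘ (+ 2) d) (/-toℚᵘ i 1) ⟩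
  ℚᵘ.mkℚᵘ (+ 2) d ℚᵘ.* ℚᵘ.mkℚᵘ i 1             ≈⟨ ℚᵘ.*≡* (identity i (+ suc d)) ⟩
  ℚᵘ.mkℚᵘ i d                                  ≈⟨ /-toℚᵘ i d ⟨
  toℚᵘ (i / suc d)                             ∎)
  where
  open ℚᵘ.≃-Reasoning
  identity : ∀ i D → (+ 2 ℤ.* i) ℤ.* D ≡ i ℤ.* (D ℤ.* + 2)
  identity = solve-∀

lemma5p1 : (m : ℕ) → (zm zm1 : ℚ) → IsOptimalValue (suc m) zm → IsOptimalValue (suc (suc m)) zm1 →
    zm1 ≤ zm + ((+ φ (suc (suc m))) / (suc (suc m) * suc (suc m)))
lemma5p1 m zm zm1 ((Y , feasible , objY≡zm) , _) (_ , minimal) = begin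
  zm1                                 ≤⟨ minimal (Y ⊕ c) (Feasible-⊕ Y c feasible φ≤2c 0≤c) ⟩
  objective (suc (suc m)) (Y ⊕ c)     ≡⟨ objective-⊕ Y c ⟩
  objective (suc m) Y + ((+ 2) / M²) *ℚ c
                                      ≡⟨ cong₂ _+_ objY≡zm (two/d*half (+ φ M) _) ⟩
  zm + (+ φ M) / M²                   ∎
  where
  open ≤-Reasoning
  M M² : ℕ
  M = suc (suc m)
  M² = M * M
  c : ℚ
  c = (+ φ M) / 2
  φ≤2c : (+ φ M) / 1 ≤ c + c
  φ≤2c = ≤-reflexive (sym (half+half (+ φ M)))
  0≤c : 0ℚ ≤ c
  0≤c = nonNegative⁻¹ c {{normalize-nonNeg (φ M) 2}}
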